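{- If $N$ is an odd positive integer with $\sigma^*(\sigma^*(N))=2N$, then $\sigma^*(N)=2^{f_1}q^{f_2}$ for some odd prime $q$ and positive integers $f_1,f_2$. Moreover, $q^{f_2}+1$ is not divisible by $4$.
   Context: For a positive integer $n$, a divisor $d$ of $n$ is a unitary divisor if $\gcd(d,n/d)=1$; $\sigma^*(n)$ is the sum of all unitary divisors of $n$. -}

module Defs where

open import Data.Nat using (ℕ; zero; suc; _+_; _*_; _≟_)
open import Data.Nat.Divisibility using (_∣_; _∣?_)
open import Data.Nat.GCD using (gcd)
open import Data.List using (List; filter; upTo; map)
open import Data.Nat.ListAction using (sum)
open import Data.Product using (_×_)
open import Relation.Binary.PropositionalEquality using (_≡_)
open import Relation.Nullary.Decidable using (Dec; _×-dec_)

open import Data.Nat.DivMod using (_/_)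

quot : ℕ → ℕ → ℕ
quot n zero = 0
quot n (suc k) = n / suc k

IsUnitaryDivisor : ℕ → ℕ → Set
IsUnitaryDivisor n d = (d ∣ n) × (gcd d (quot n d) ≡ 1)

isUnitaryDivisor? : ∀ n d → Dec (IsUnitaryDivisor n d)
isUnitaryDivisor? n d = (d ∣? n) ×-dec (gcd d (quot n d) ≟ 1)

unitaryDivisors : ℕ → List ℕ
unitaryDivisors n = filter (isUnitaryDivisor? n) (map suc (upTo n))

σ* : ℕ → ℕ
σ* n = sum (unitaryDivisors n)

{-# OPTIONS --safe #-}
-- Write σ*(N) = 2^e m with m odd. As N > 1 is odd, σ*(N) is even, so e ≥ 1, and since
-- σ*(p^k b) = (1 + p^k) σ*(b) for prime p ∤ b and k ≥ 1, we get 2N = (1 + 2^e) σ*(m). Thus 4 ∤ σ*(m), and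
-- m ≠ 1 because 1 + 2^e is odd. Every odd prime power q^f ∥ m contributes the even factor
-- 1 + q^f to σ*(m), and every odd r > 1 has σ*(r) even; so m = q^f is a single prime power
-- and 4 ∤ 1 + q^f.
module Submission where

open import Defs
open import Data.Empty using (⊥-elim)
open import Data.List using (List; []; _∷_; _++_; map; upTo)
open import Data.List.Membership.Propositional using (_∈_)
open import Data.List.Membership.Propositional.Properties
  using (∈-++⁻; ∈-++⁺ˡ; ∈-++⁺ʳ; ∈-map⁺; ∈-map⁻; ∈-filter⁺; ∈-filter⁻; ∈-upTo⁺)
open import Data.List.Membership.Setoid.Properties using (unique⇒irrelevant)
open import Data.List.Relation.Binary.BagAndSetEquality using (∼bag⇒↭)
open import Data.List.Relation.Binary.Disjoint.Propositional using (Disjoint)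
open import Data.List.Relation.Unary.All using (_∷_)
open import Data.List.Relation.Unary.Any using (here; there)
open import Data.List.Relation.Unary.Unique.Propositional using (Unique)
import Data.List.Relation.Unary.Unique.Propositional.Properties as Unique
open import Data.Nat
  using (ℕ; zero; suc; _+_; _*_; _^_; _≤_; _<_; _≥_; z≤n; s≤s; NonZero; >-nonZero; >-nonZero⁻¹)
open import Data.Nat.Coprimality
  using (Coprime; 1-coprimeTo; coprime-divisor; gcd≡1⇒coprime; coprime⇒gcd≡1)
import Data.Nat.Coprimality as Coprime
open import Data.Nat.Divisibility
  using (_∣_; divides; _∣?_; ∣-refl; ∣-trans; ∣1⇒≡1; m∣m*n; n∣m*n; ∣m⇒∣m*n; ∣n⇒∣m*n
        ; ∣m∣n⇒∣m+n; ∣m+n∣m⇒∣n; *-cancelˡ-∣; *-pres-∣; ∣⇒≤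
        ; quotient; m∣n⇒n≡m*quotient; quotient-<; quotient≢0; n/m≡quotient)
open import Data.Nat.GCD using (gcd)
open import Data.Nat.Induction using (<-wellFounded)
open import Data.Nat.ListAction using (sum; product)
open import Data.Nat.ListAction.Properties using (sum-↭; sum-++)
open import Data.Nat.Primality
  using (Prime; prime⇒irreducible; ¬prime[1]; prime⇒nonZero; prime⇒nonTrivial; prime[2]; euclidsLemma)
open import Data.Nat.Primality.Factorisation using (factorise)
open import Data.Nat.Properties
  using (+-comm; *-comm; *-assoc; *-zeroʳ; *-distribˡ-+; *-identityˡ; *-identityʳ; *-cancelˡ-≡
        ; suc-injective; ≡-irrelevant; m≤n*m; m≤m+n; m≤n+m; ≤-trans; ≤∧≢⇒<; m^n≢0
        ; *-commutativeSemigroup)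
open import Algebra.Properties.CommutativeSemigroup *-commutativeSemigroup using (x∙yz≈y∙xz)
open import Data.Product using (Σ; _×_; _,_; ∃-syntax)
open import Data.Sum using (inj₁; inj₂)
open import Function using (_∘_)
open import Function.Bundles using (mk↔ₛ′)
open import Induction.WellFounded using (Acc; acc)
open import Relation.Nullary using (¬_; yes; no)
open import Relation.Binary.PropositionalEquality
  using (_≡_; refl; sym; trans; cong; subst; setoid; module ≡-Reasoning)

private
  variable
    p k m n b : ℕ

sum-unique-cong : ∀ {xs ys : List ℕ} → Unique xs → Unique ys →
  (∀ {z} → z ∈ xs → z ∈ ys) → (∀ {z} → z ∈ ys → z ∈ xs) → sum xs ≡ sum ys
sum-unique-cong uxs uys to from =
  sum-↭ (∼bag⇒↭ (mk↔ₛ′ to from (λ _ → ∈-irrelevant uys _ _) (λ _ → ∈-irrelevant uxs _ _)))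
  where ∈-irrelevant = unique⇒irrelevant (setoid ℕ) ≡-irrelevant

sum-map-*ˡ : ∀ c (xs : List ℕ) → sum (map (c *_) xs) ≡ c * sum xs
sum-map-*ˡ c []       = sym (*-zeroʳ c)
sum-map-*ˡ c (x ∷ xs) = trans (cong (c * x +_) (sum-map-*ˡ c xs)) (sym (*-distribˡ-+ c x (sum xs)))

coprime-* : Coprime m n → Coprime m k → Coprime m (n * k)
coprime-* m⊥n m⊥k (d∣m , d∣nk) =
  m⊥k (d∣m , coprime-divisor (λ (e∣d , e∣n) → m⊥n (∣-trans e∣d d∣m , e∣n)) d∣nk)

coprime-∣ˡ : k ∣ m → Coprime m n → Coprime k n
coprime-∣ˡ k∣m m⊥n (d∣k , d∣n) = m⊥n (∣-trans d∣k k∣m , d∣n)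

coprime-∣ʳ : k ∣ n → Coprime m n → Coprime m k
coprime-∣ʳ k∣n m⊥n (d∣m , d∣k) = m⊥n (d∣m , ∣-trans d∣k k∣n)

prime∤⇒coprime : Prime p → ¬ p ∣ m → Coprime m p
prime∤⇒coprime pp p∤m (d∣m , d∣p) with prime⇒irreducible pp d∣p
... | inj₁ d≡1 = d≡1
... | inj₂ refl = ⊥-elim (p∤m d∣m)

prime∤⇒coprime-^ : Prime p → ¬ p ∣ m → ∀ k → Coprime m (p ^ k)
prime∤⇒coprime-^ pp p∤m zero    (_ , d∣1) = ∣1⇒≡1 d∣1
prime∤⇒coprime-^ pp p∤m (suc k) = coprime-* (prime∤⇒coprime pp p∤m) (prime∤⇒coprime-^ pp p∤m k)

prime∤⇒∤^ : Prime p → ¬ p ∣ m → ∀ k → ¬ p ∣ m ^ k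
prime∤⇒∤^ pp p∤m zero    p∣1 = ¬prime[1] (subst Prime (∣1⇒≡1 p∣1) pp)
prime∤⇒∤^ {m = m} pp p∤m (suc k) p∣m^k+1 with euclidsLemma m (m ^ k) pp p∣m^k+1
... | inj₁ p∣m   = p∤m p∣m
... | inj₂ p∣m^k = prime∤⇒∤^ pp p∤m k p∣m^k

prime∣coprime⇒∤ : Prime p → Coprime m n → p ∣ m → ¬ p ∣ n
prime∣coprime⇒∤ pp m⊥n p∣m p∣n = ¬prime[1] (subst Prime (m⊥n (p∣m , p∣n)) pp)

factor-coprime : ∀ x e .{{_ : NonZero n}} → x * e ≡ n * b → Coprime n e →
  ∃[ y ] x ≡ n * y × y * e ≡ b
factor-coprime {n} {b} x e xe≡nb n⊥e = y , x≡ny , *-cancelˡ-≡ (y * e) b n ny·e≡nb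
  where
  n∣x : n ∣ x
  n∣x = coprime-divisor n⊥e (divides b (trans (*-comm e x) (trans xe≡nb (*-comm n b))))
  y = quotient n∣x
  x≡ny = m∣n⇒n≡m*quotient n∣x
  ny·e≡nb : n * (y * e) ≡ n * b
  ny·e≡nb = trans (sym (*-assoc n y e)) (trans (cong (_* e) (sym x≡ny)) xe≡nb)

∈-unitaryDivisors⁻ : ∀ {x} → x ∈ unitaryDivisors n → ∃[ e ] x * e ≡ n × Coprime x e
∈-unitaryDivisors⁻ {n} x∈ with ∈-filter⁻ (isUnitaryDivisor? n) {xs = map suc (upTo n)} x∈
... | x∈range , (x∣n , gcd≡1) with ∈-map⁻ suc x∈range
... | k , _ , refl =
  quotient x∣n , sym (m∣n⇒n≡m*quotient x∣n) ,
  gcd≡1⇒coprime (subst (λ y → gcd (suc k) y ≡ 1) (n/m≡quotient x∣n) gcd≡1)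

∈-unitaryDivisors⁺ : ∀ {x e} → 1 ≤ n → x * e ≡ n → Coprime x e → x ∈ unitaryDivisors n
∈-unitaryDivisors⁺ {x = zero} () refl _
∈-unitaryDivisors⁺ {n} {x = suc k} {e} n≥1 xe≡n x⊥e =
  ∈-filter⁺ (isUnitaryDivisor? n) (∈-map⁺ suc (∈-upTo⁺ (∣⇒≤ {{>-nonZero n≥1}} x∣n)))
    (x∣n , subst (λ y → gcd (suc k) y ≡ 1) (sym (n/m≡quotient x∣n)) (coprime⇒gcd≡1 x⊥e))
  where
  x∣n : suc k ∣ n
  x∣n = divides e (trans (sym xe≡n) (*-comm (suc k) e))

unique-unitaryDivisors : ∀ n → Unique (unitaryDivisors n)
unique-unitaryDivisors n =
  Unique.filter⁺ (isUnitaryDivisor? n) (Unique.map⁺ suc-injective (Unique.upTo⁺ n))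

unitaryDivisor-∣ : ∀ {x} → x ∈ unitaryDivisors n → x ∣ n
unitaryDivisor-∣ {n} x∈ with ∈-unitaryDivisors⁻ {n} x∈
... | e , refl , _ = m∣m*n e

module _ {p b : ℕ} (pp : Prime p) (p∤b : ¬ p ∣ b) (b≥1 : 1 ≤ b) (k : ℕ) where

  private
    P : ℕ
    P = p ^ suc k

    instance
      P≢0 : NonZero P
      P≢0 = m^n≢0 p (suc k) {{prime⇒nonZero pp}}

    P*b≥1 : 1 ≤ P * b
    P*b≥1 = ≤-trans b≥1 (m≤n*m b P)

    factor-∤ : ∀ {x e} → x * e ≡ b → ¬ p ∣ x
    factor-∤ {x} {e} xe≡b p∣x = p∤b (∣-trans p∣x (subst (x ∣_) xe≡b (m∣m*n e)))

    coprime-P : ∀ {x} → ¬ p ∣ x → Coprime x P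
    coprime-P p∤x = prime∤⇒coprime-^ pp p∤x (suc k)

    candidates : List ℕ
    candidates = unitaryDivisors b ++ map (P *_) (unitaryDivisors b)

    unique-candidates : Unique candidates
    unique-candidates = Unique.++⁺ (unique-unitaryDivisors b)
      (Unique.map⁺ (*-cancelˡ-≡ _ _ P) (unique-unitaryDivisors b)) disjoint
      where
      disjoint : Disjoint (unitaryDivisors b) (map (P *_) (unitaryDivisors b))
      disjoint (v∈ , Pv∈) with ∈-map⁻ (P *_) Pv∈
      ... | y , _ , refl = p∤b (∣-trans (∣-trans (m∣m*n (p ^ k)) (m∣m*n y)) (unitaryDivisor-∣ v∈))

    -- If p ∣ x then p ∤ e, so P ∣ x; otherwise P ∣ e. Either way the remaining factor is a unitary divisor of b.
    ⊆-candidates : ∀ {x} → x ∈ unitaryDivisors (P * b) → x ∈ candidates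
    ⊆-candidates {x} x∈ with ∈-unitaryDivisors⁻ {P * b} x∈
    ... | e , xe≡Pb , x⊥e with p ∣? x
    ... | yes p∣x with factor-coprime x e xe≡Pb (Coprime.sym (coprime-P (prime∣coprime⇒∤ pp x⊥e p∣x)))
    ...   | y , refl , ye≡b =
      ∈-++⁺ʳ (unitaryDivisors b) (∈-map⁺ (P *_) (∈-unitaryDivisors⁺ b≥1 ye≡b (coprime-∣ˡ (n∣m*n P) x⊥e)))
    ⊆-candidates {x} x∈ | e , xe≡Pb , x⊥e | no p∤x
      with factor-coprime e x (trans (*-comm e x) xe≡Pb) (Coprime.sym (coprime-P p∤x))
    ...   | e′ , refl , e′x≡b =
      ∈-++⁺ˡ (∈-unitaryDivisors⁺ b≥1 (trans (*-comm x e′) e′x≡b) (coprime-∣ʳ (n∣m*n P) x⊥e))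

    ⊇-candidates : ∀ {x} → x ∈ candidates → x ∈ unitaryDivisors (P * b)
    ⊇-candidates {x} x∈ with ∈-++⁻ (unitaryDivisors b) x∈
    ... | inj₁ x∈b with ∈-unitaryDivisors⁻ {b} x∈b
    ...   | e , xe≡b , x⊥e =
      ∈-unitaryDivisors⁺ P*b≥1 (trans (x∙yz≈y∙xz x P e) (cong (P *_) xe≡b))
        (coprime-* (coprime-P (factor-∤ xe≡b)) x⊥e)
    ⊇-candidates x∈ | inj₂ x∈Pb with ∈-map⁻ (P *_) x∈Pb
    ... | y , y∈b , refl with ∈-unitaryDivisors⁻ {b} y∈b
    ...   | e , ye≡b , y⊥e =
      ∈-unitaryDivisors⁺ P*b≥1 (trans (*-assoc P y e) (cong (P *_) ye≡b))
        (Coprime.sym (coprime-* (coprime-P (factor-∤ (trans (*-comm e y) ye≡b))) (Coprime.sym y⊥e)))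

  σ*-prime^-* : σ* (p ^ suc k * b) ≡ (1 + p ^ suc k) * σ* b
  σ*-prime^-* = begin
    σ* (P * b)
      ≡⟨ sum-unique-cong (unique-unitaryDivisors (P * b)) unique-candidates ⊆-candidates ⊇-candidates ⟩
    sum candidates                               ≡⟨ sum-++ (unitaryDivisors b) _ ⟩
    σ* b + sum (map (P *_) (unitaryDivisors b))  ≡⟨ cong (σ* b +_) (sum-map-*ˡ P (unitaryDivisors b)) ⟩
    σ* b + P * σ* b                              ∎
    where open ≡-Reasoning

PrimePowerSplit : ℕ → ℕ → ℕ → Set
PrimePowerSplit p k n = ∃[ b ] n ≡ p ^ k * b × ¬ p ∣ b × 1 ≤ b

primePowerSplit : Prime p → 1 ≤ n → ∃[ k ] PrimePowerSplit p k n
primePowerSplit {p} {n} pp n≥1 = go n≥1 (<-wellFounded n)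
  where
  go : ∀ {n} → 1 ≤ n → Acc _<_ n → ∃[ k ] PrimePowerSplit p k n
  go {n} n≥1 (acc rec) with p ∣? n
  ... | no p∤n = 0 , n , sym (*-identityˡ n) , p∤n , n≥1
  ... | yes p∣n =
    let instance
          n≢0 : NonZero n
          n≢0 = >-nonZero n≥1
        q = quotient p∣n
        k , b , q≡p^k*b , p∤b , b≥1 =
          go (>-nonZero⁻¹ q {{quotient≢0 p∣n}}) (rec (quotient-< p∣n {{prime⇒nonTrivial pp}}))
    in suc k , b , trans (m∣n⇒n≡m*quotient p∣n) (trans (cong (p *_) q≡p^k*b) (sym (*-assoc p (p ^ k) b))) ,
       p∤b , b≥1

primePowerSplit-∣ : Prime p → p ∣ n → 1 ≤ n → ∃[ k ] PrimePowerSplit p (suc k) n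
primePowerSplit-∣ {p} {n} pp p∣n n≥1 with primePowerSplit {n = n} pp n≥1
... | zero  , b , n≡1*b , p∤b , _ = ⊥-elim (p∤b (subst (p ∣_) (trans n≡1*b (*-identityˡ b)) p∣n))
... | suc k , split = k , split

primePowerFactor : 2 ≤ n → ∃[ p ] Prime p × ∃[ k ] PrimePowerSplit p (suc k) n
primePowerFactor {suc zero} (s≤s ())
primePowerFactor {n@(suc (suc _))} _ with factorise n
... | record { factors = [] ; isFactorisation = () }
... | record { factors = p ∷ ps ; isFactorisation = n≡p*ps ; factorsPrime = pp ∷ _ } =
  p , pp , primePowerSplit-∣ pp (divides (product ps) (trans n≡p*ps (*-comm p _))) (s≤s z≤n)

odd⇒2∣suc : ¬ 2 ∣ m → 2 ∣ suc m
odd⇒2∣suc {zero}          2∤0   = ⊥-elim (2∤0 (divides 0 refl))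
odd⇒2∣suc {suc zero}      _     = divides 1 refl
odd⇒2∣suc {suc (suc m)}   2∤2+m = ∣m∣n⇒∣m+n {m = 2} ∣-refl (odd⇒2∣suc (λ 2∣m → 2∤2+m (∣m∣n⇒∣m+n ∣-refl 2∣m)))

even⇒¬2∣suc : 2 ∣ m → ¬ 2 ∣ suc m
even⇒¬2∣suc {m} 2∣m 2∣1+m with ∣1⇒≡1 (∣m+n∣m⇒∣n (subst (2 ∣_) (+-comm 1 m) 2∣1+m) 2∣m)
... | ()

odd⇒2∣σ* : 2 ≤ n → ¬ 2 ∣ n → 2 ∣ σ* n
odd⇒2∣σ* n≥2 2∤n with primePowerFactor n≥2
... | p , pp , k , b , refl , p∤b , b≥1 =
  subst (2 ∣_) (sym (σ*-prime^-* pp p∤b b≥1 k))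
    (∣m⇒∣m*n (σ* b) (odd⇒2∣suc (prime∤⇒∤^ prime[2] 2∤p (suc k))))
  where
  2∤p : ¬ 2 ∣ p
  2∤p 2∣p = 2∤n (∣-trans 2∣p (∣m⇒∣m*n b (m∣m*n (p ^ k))))

¬2∣σ*⇒≡1 : 1 ≤ n → ¬ 2 ∣ n → ¬ 2 ∣ σ* n → n ≡ 1
¬2∣σ*⇒≡1 {suc zero}    _ _   _     = refl
¬2∣σ*⇒≡1 {suc (suc _)} _ 2∤n 2∤σ*n = ⊥-elim (2∤σ*n (odd⇒2∣σ* (s≤s (s≤s z≤n)) 2∤n))

∈⇒≤sum : ∀ {x xs} → x ∈ xs → x ≤ sum xs
∈⇒≤sum {xs = x ∷ xs} (here refl) = m≤m+n x (sum xs)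
∈⇒≤sum {xs = y ∷ _}  (there x∈)  = ≤-trans (∈⇒≤sum x∈) (m≤n+m _ y)

σ*≥1 : 1 ≤ n → 1 ≤ σ* n
σ*≥1 {n} n≥1 = ∈⇒≤sum (∈-unitaryDivisors⁺ n≥1 (*-identityˡ n) (1-coprimeTo n))

¬4∣σ*⇒prime^ : 2 ≤ m → ¬ 2 ∣ m → ¬ 4 ∣ σ* m →
  ∃[ q ] ∃[ f ] Prime q × ¬ 2 ∣ q × m ≡ q ^ suc f × ¬ 4 ∣ q ^ suc f + 1
¬4∣σ*⇒prime^ m≥2 2∤m 4∤σ*m with primePowerFactor m≥2
... | q , qp , f , b , refl , q∤b , b≥1 =
  q , f , qp , 2∤q , trans (cong (Q *_) b≡1) (*-identityʳ Q) , 4∤Q+1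
  where
  Q = q ^ suc f

  2∤q : ¬ 2 ∣ q
  2∤q 2∣q = 2∤m (∣-trans 2∣q (∣m⇒∣m*n b (m∣m*n (q ^ f))))

  2∤b : ¬ 2 ∣ b
  2∤b 2∣b = 2∤m (∣-trans 2∣b (n∣m*n Q))

  4∤[1+Q]*σ*b : ¬ 4 ∣ (1 + Q) * σ* b
  4∤[1+Q]*σ*b = 4∤σ*m ∘ subst (4 ∣_) (sym (σ*-prime^-* qp q∤b b≥1 f))

  b≡1 : b ≡ 1
  b≡1 = ¬2∣σ*⇒≡1 b≥1 2∤b λ 2∣σ*b →
    4∤[1+Q]*σ*b (*-pres-∣ (odd⇒2∣suc (prime∤⇒∤^ prime[2] 2∤q (suc f))) 2∣σ*b)

  4∤Q+1 : ¬ 4 ∣ Q + 1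
  4∤Q+1 4∣Q+1 = 4∤[1+Q]*σ*b (∣m⇒∣m*n (σ* b) (subst (4 ∣_) (+-comm Q 1) 4∣Q+1))

lemma3p1 : (N : ℕ) → N ≥ 1 → ¬ (2 ∣ N) → σ* (σ* N) ≡ 2 * N →
    Σ ℕ (λ q → Σ ℕ (λ f₁ → Σ ℕ (λ f₂ →
      Prime q × ¬ (2 ∣ q) × f₁ ≥ 1 × f₂ ≥ 1 ×
      σ* N ≡ 2 ^ f₁ * q ^ f₂ × ¬ (4 ∣ q ^ f₂ + 1))))
lemma3p1 zero       ()
lemma3p1 (suc zero) _ _ ()
lemma3p1 N@(suc (suc _)) N≥1 2∤N σ*σ*N≡2N
  with primePowerSplit-∣ prime[2] (odd⇒2∣σ* (s≤s (s≤s z≤n)) 2∤N) (σ*≥1 N≥1)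
... | e , m , σ*N≡2^[1+e]*m , 2∤m , m≥1 =
  let q , f , qp , 2∤q , m≡q^[1+f] , 4∤q^[1+f]+1 = ¬4∣σ*⇒prime^ 2≤m 2∤m 4∤σ*m
  in q , suc e , suc f , qp , 2∤q , s≤s z≤n , s≤s z≤n ,
     trans σ*N≡2^[1+e]*m (cong (2 ^ suc e *_) m≡q^[1+f]) , 4∤q^[1+f]+1
  where
  2N≡[1+2^[1+e]]*σ*m : 2 * N ≡ (1 + 2 ^ suc e) * σ* m
  2N≡[1+2^[1+e]]*σ*m =
    trans (sym σ*σ*N≡2N) (trans (cong σ* σ*N≡2^[1+e]*m) (σ*-prime^-* prime[2] 2∤m m≥1 e))

  4∤σ*m : ¬ 4 ∣ σ* m
  4∤σ*m 4∣σ*m = 2∤N (*-cancelˡ-∣ 2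
    (subst (4 ∣_) (sym 2N≡[1+2^[1+e]]*σ*m) (∣n⇒∣m*n (1 + 2 ^ suc e) 4∣σ*m)))

  2N≡1+2^[1+e] : 1 ≡ m → 2 * N ≡ 1 + 2 ^ suc e
  2N≡1+2^[1+e] refl = trans 2N≡[1+2^[1+e]]*σ*m (*-identityʳ (1 + 2 ^ suc e))

  2≤m : 2 ≤ m
  2≤m = ≤∧≢⇒< m≥1 λ 1≡m → even⇒¬2∣suc (m∣m*n (2 ^ e))
    (subst (2 ∣_) (2N≡1+2^[1+e] 1≡m) (m∣m*n N))
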